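{- Let $A$ be an associative, commutative, unital algebra with a Rota–Baxter operator $R$, let $\gamma\in A$, and let $\mathcal I$, $a=-(\mathcal I-e)$ be as in the context. Let $H:=\sum_{n\ge0}(-1)^n(Ra)^{\{n\}}:\mathbf{Hqsh}\to A$ (which equals $F_{ -1}\circ\mathbf{rev}$ with $F_{ -1}=\sum_{n\ge 0}(-1)^n(Ra)^{[n]}$) and $H^<:=H\circ\alpha:\mathbf{Hck}\to A$. Then for forests of $\mathbf{Hck}$: (i) if $\underline\omega^<=\underline\omega^{1<}\cdots\underline\omega^{r<}$ is a product of trees $\underline\omega^{i<}$, then $H^<(\underline\omega^{1<}\cdots\underline\omega^{r<})=H^<(\underline\omega^{1<})\cdots H^<(\underline\omega^{r<})$; (ii) if $\underline\omega^<=B^+_{\omega_1}(\underline\omega^{1<}\cdots\underline\omega^{l<})$ is a tree with root decorated by $\omega_1$ and subtrees $\underline\omega^{1<},\dots,\underline\omega^{l<}$ (possibly $l=0$), then, writing $'\underline\omega^<=\underline\omega^{1<}\cdots\underline\omega^{l<}$, $$H^<(\underline\omega^<)=-R\big(a(\omega_1)\,H^<('\underline\omega^<)\big)=R\big(\gamma^{\omega_1}H^<('\underline\omega^<)\big).$$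
   Context: Alphabet $\Omega=\{1,2,3,\dots\}$. Words, the quasi-shuffle Hopf algebra $\mathbf{Hqsh}$ (quasi-shuffle product $(a\underline m)\ast(b\underline n)=a(\underline m\ast b\underline n)+b(a\underline m\ast\underline n)+(a+b)(\underline m\ast\underline n)$, deconcatenation coproduct), $\mathbf{rev}$ (word reversal). Convolution of linear maps $\mathbf{Hqsh}\to A$: $(f\star g)(\underline\omega)=\sum_{\underline\omega^1\underline\omega^2=\underline\omega}f(\underline\omega^1)g(\underline\omega^2)$, unit $e$ ($e(\emptyset)=1_A$, $0$ otherwise). $\mathcal I$ is the linear map with $\mathcal I(\emptyset)=1_A$, $\mathcal I((\omega))=\gamma^\omega$ on one-letter words, $0$ on longer words; $a=-(\mathcal I-e)$. For a linear operator $P$ on $A$: $(Pa)^{[0]}=(Pa)^{\{0\}}=e$, $(Pa)^{[n+1]}=P\circ((Pa)^{[n]}\star a)$, $(Pa)^{\{n+1\}}=P\circ(a\star(Pa)^{\{n\}})$; sums over $n$ are evaluated wordwise. $\mathbf{Hck}$ is the Connes–Kreimer Hopf algebra of rooted forests whose vertices are decorated by elements of $\Omega$; the product is disjoint union of forests (unit: the empty forest), and for $\eta\in\Omega$, $B^+_\eta$ maps a forest to the tree obtained by adding a new root decorated by $\eta$ joined to the roots of all its trees; the coproduct is defined by $\Delta(\emptyset)=\emptyset\otimes\emptyset$, multiplicativity, and $\Delta(B^+_\eta(f))=\emptyset\otimes B^+_\eta(f)+(B^+_\eta\otimes\mathrm{id})\Delta(f)$. For $\omega\in\Omega$ let $L_\omega$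 be the linear map on $\mathbf{Hqsh}$ with $L_\omega(\underline\omega)=\omega\underline\omega$ (concatenation on the left). The arborification morphism $\alpha:\mathbf{Hck}\to\mathbf{Hqsh}$ is the unique bialgebra morphism with $\alpha(\emptyset)=\emptyset$ and $\alpha\circ B^+_\omega=L_\omega\circ\alpha$ for every $\omega\in\Omega$. -}

module Defs where

open import Level using (Level)
open import Data.Nat as ℕ using (ℕ; zero; suc)
open import Data.List as List using (List; []; _∷_; [_]; _++_; map; concatMap; length)
open import Data.Product using (_×_; _,_)
open import Algebra.Bundles using (CommutativeRing)

-- The alphabet Ω = {1,2,3,...}.  A letter is stored by its predecessor:
-- the letter `letter p` is the positive integer (suc p).
record Ω : Set where
  constructor letter
  field pred : ℕ

value : Ω → ℕ
value (letter p) = suc p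

-- addition of letters (as positive integers): (p+1)+(q+1) = (p+q+1)+1
_+Ω_ : Ω → Ω → Ω
letter p +Ω letter q = letter (suc (p ℕ.+ q))

Word : Set
Word = List Ω

-- Elements of Hqsh that arise as formal sums of words with coefficient 1
-- (all that is needed: products of words and images of forests under α).
FSum : Set
FSum = List Word

_∗_ : Word → Word → FSum
[] ∗ v = [ v ]
(a ∷ m) ∗ [] = [ a ∷ m ]
(a ∷ m) ∗ (b ∷ n) =
  map (a ∷_) (m ∗ (b ∷ n)) ++ map (b ∷_) ((a ∷ m) ∗ n) ++ map ((a +Ω b) ∷_) (m ∗ n)

_⊛_ : FSum → FSum → FSum
xs ⊛ ys = concatMap (λ u → concatMap (λ v → u ∗ v) ys) xs

splits : Word → List (Word × Word)
splits [] = [ ([] , []) ]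
splits (x ∷ w) = ([] , x ∷ w) ∷ map (λ { (u , v) → (x ∷ u , v) }) (splits w)

-- Decorated rooted forests (Connes–Kreimer Hopf algebra Hck, basis).
-- A forest is a (formal, commutative) product of trees, listed.
mutual
  data Tree : Set where
    B⁺ : Ω → Forest → Tree

  Forest : Set
  Forest = List Tree

mutual
  αT : Tree → FSum
  αT (B⁺ ω f) = map (ω ∷_) (α f)

  α : Forest → FSum
  α [] = [ [] ]
  α (t ∷ f) = αT t ⊛ α f

module _ {c ℓ : Level} (A : CommutativeRing c ℓ) where
  open CommutativeRing A

  record IsRotaBaxter (R : Carrier → Carrier) : Set (c Level.⊔ ℓ) where
    field
      R-cong  : ∀ {x y} → x ≈ y → R x ≈ R y
      R-+     : ∀ x y → R (x + y) ≈ R x + R y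
      R-RB    : ∀ x y → R x * R y ≈ R (R x * y + x * R y + x * y)

module Setup {c ℓ : Level} (A : CommutativeRing c ℓ) (γ : CommutativeRing.Carrier A)
             (R : CommutativeRing.Carrier A → CommutativeRing.Carrier A) where
  open CommutativeRing A

  _^_ : Carrier → ℕ → Carrier
  x ^ zero = 1#
  x ^ suc n = x * (x ^ n)

  γ^ : Ω → Carrier
  γ^ ω = γ ^ value ω

  e : Word → Carrier
  e [] = 1#
  e (_ ∷ _) = 0#

  I : Word → Carrier
  I [] = 1#
  I (ω ∷ []) = γ^ ω
  I (_ ∷ _ ∷ _) = 0#

  a : Word → Carrier
  a w = - (I w - e w)

  sumA : List Carrier → Carrier
  sumA = List.foldr _+_ 0#

  prodA : List Carrier → Carrier
  prodA = List.foldr _*_ 1#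

  _⋆_ : (Word → Carrier) → (Word → Carrier) → Word → Carrier
  (f ⋆ g) w = sumA (map (λ { (u , v) → f u * g v }) (splits w))

  Ra^ : ℕ → Word → Carrier
  Ra^ zero = e
  Ra^ (suc n) w = R ((a ⋆ Ra^ n) w)

  sgn : ℕ → Carrier → Carrier
  sgn zero x = x
  sgn (suc n) x = - sgn n x

  -- H = Σ_{n≥0} (-1)^n (Ra)^{n}, evaluated wordwise; on a word w all terms
  -- with n > length w vanish (a(∅) = 0), so the sum is over n ≤ length w.
  H : Word → Carrier
  H w = sumA (map (λ n → sgn n (Ra^ n w)) (List.upTo (suc (length w))))

  Hˡ : FSum → Carrier
  Hˡ xs = sumA (map H xs)

  H< : Forest → Carrier
  H< f = Hˡ (α f)

module Submission where

open import Defs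
open import Level using (Level)
open import Data.List using (List; []; _∷_; [_]; map)
open import Data.Product using (_×_)
open import Algebra.Bundles using (CommutativeRing)

open import Data.Product using (_,_)
open import Data.Nat as ℕ using (ℕ; zero; suc)
open import Data.Nat.Properties using (+-suc)
open import Data.List using (_++_; foldr; applyUpTo; upTo; concatMap; length)
open import Data.List.Properties using (map-∘; map-applyUpTo; map-upTo)
import Relation.Binary.PropositionalEquality as ≡
import Algebra.Properties.Ring as RingProperties
import Algebra.Properties.CommutativeSemigroup as CommutativeSemigroupProperties
import Relation.Binary.Reasoning.Setoid as SetoidReasoning

-- On words, convolving with a only sees the first letter (a vanishes on the
-- empty word and on words of length ≥ 2), which gives H (ω w) = R (γ^ω H w).
-- Unfolding both factors of H u * H v with this recursion, the weight-one
-- Rota–Baxter identity R p * R q = R (p R q + R p q + p q) reproduces exactly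
-- the three branches of the quasi-shuffle recursion (using γ^(x+y) = γ^x γ^y
-- for the contracted letter), so H is a character of the quasi-shuffle
-- algebra.  Since α is multiplicative and intertwines B⁺_ω with L_ω, both
-- properties pass to H^< = H ∘ α.

module RotaBaxterOperator {c ℓ : Level} (A : CommutativeRing c ℓ)
  {R : CommutativeRing.Carrier A → CommutativeRing.Carrier A} (rb : IsRotaBaxter A R) where
  open CommutativeRing A
  open IsRotaBaxter rb
  open RingProperties ring
  open SetoidReasoning setoid

  R-zero : R 0# ≈ 0#
  R-zero = x+x≈x⇒x≈0 (R 0#) (trans (sym (R-+ 0# 0#)) (R-cong (+-identityʳ 0#)))

  R-neg : ∀ x → R (- x) ≈ - R x
  R-neg x = +-inverseˡ-unique (R (- x)) (R x)
    (trans (sym (R-+ (- x) x)) (trans (R-cong (-‿inverseˡ x)) R-zero))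

  R-sum-scale : ∀ {X : Set} k (F : X → Carrier) xs
              → foldr _+_ 0# (map (λ x → R (k * F x)) xs) ≈ R (k * foldr _+_ 0# (map F xs))
  R-sum-scale k F [] = sym (trans (R-cong (zeroʳ k)) R-zero)
  R-sum-scale k F (x ∷ xs) = begin
      R (k * F x) + foldr _+_ 0# (map (λ x → R (k * F x)) xs)
    ≈⟨ +-congˡ (R-sum-scale k F xs) ⟩
      R (k * F x) + R (k * foldr _+_ 0# (map F xs))
    ≈⟨ R-+ _ _ ⟨
      R (k * F x + k * foldr _+_ 0# (map F xs))
    ≈⟨ R-cong (distribˡ k _ _) ⟨
      R (k * (F x + foldr _+_ 0# (map F xs))) ∎

  R*R-expand : ∀ p q → R p * R q ≈ R (p * R q) + (R (R p * q) + R (p * q))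
  R*R-expand p q = begin
      R p * R q
    ≈⟨ R-RB p q ⟩
      R (R p * q + p * R q + p * q)
    ≈⟨ R-cong (+-congʳ (+-comm _ _)) ⟩
      R (p * R q + R p * q + p * q)
    ≈⟨ R-cong (+-assoc _ _ _) ⟩
      R (p * R q + (R p * q + p * q))
    ≈⟨ trans (R-+ _ _) (+-congˡ (R-+ _ _)) ⟩
      R (p * R q) + (R (R p * q) + R (p * q)) ∎

module Properties {c ℓ : Level} (A : CommutativeRing c ℓ)
  (R : CommutativeRing.Carrier A → CommutativeRing.Carrier A)
  (rb : IsRotaBaxter A R) (γ : CommutativeRing.Carrier A) where
  open CommutativeRing A
  open Setup A γ R
  open IsRotaBaxter rb using (R-cong)
  open RotaBaxterOperator A rb
  open RingProperties ring
  open CommutativeSemigroupProperties *-commutativeSemigroup using (x∙yz≈y∙xz; interchange)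
  open SetoidReasoning setoid

  sumA-cong : ∀ {X : Set} {F G : X → Carrier} → (∀ x → F x ≈ G x) → ∀ xs
            → sumA (map F xs) ≈ sumA (map G xs)
  sumA-cong F≈G [] = refl
  sumA-cong F≈G (x ∷ xs) = +-cong (F≈G x) (sumA-cong F≈G xs)

  sgn-cong : ∀ n {x y} → x ≈ y → sgn n x ≈ sgn n y
  sgn-cong zero x≈y = x≈y
  sgn-cong (suc n) x≈y = -‿cong (sgn-cong n x≈y)

  sgn-suc : ∀ n x → sgn (suc n) x ≈ sgn n (- x)
  sgn-suc zero x = refl
  sgn-suc (suc n) x = -‿cong (sgn-suc n x)

  sgn-commute : (f : Carrier → Carrier) → (∀ {x y} → x ≈ y → f x ≈ f y)
              → (∀ x → f (- x) ≈ - f x) → ∀ n x → f (sgn n x) ≈ sgn n (f x)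
  sgn-commute f f-cong f-neg zero x = refl
  sgn-commute f f-cong f-neg (suc n) x =
    trans (f-neg _) (-‿cong (sgn-commute f f-cong f-neg n x))

  ^-+ : ∀ x m n → x ^ (m ℕ.+ n) ≈ x ^ m * x ^ n
  ^-+ x zero n = sym (*-identityˡ _)
  ^-+ x (suc m) n = trans (*-congˡ (^-+ x m n)) (sym (*-assoc _ _ _))

  γ^-+Ω : ∀ x y → γ^ (x +Ω y) ≈ γ^ x * γ^ y
  γ^-+Ω (letter p) (letter q) = begin
      γ ^ suc (suc (p ℕ.+ q))
    ≡⟨ ≡.cong (λ n → γ ^ suc n) (+-suc p q) ⟨
      γ ^ (suc p ℕ.+ suc q)
    ≈⟨ ^-+ γ (suc p) (suc q) ⟩
      γ ^ suc p * γ ^ suc q ∎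

  x-0#≈x : ∀ x → x - 0# ≈ x
  x-0#≈x x = trans (+-congˡ -0#≈0#) (+-identityʳ x)

  a-empty : a [] ≈ 0#
  a-empty = trans (-‿cong (-‿inverseʳ 1#)) -0#≈0#

  a-long : ∀ x y w → a (x ∷ y ∷ w) ≈ 0#
  a-long x y w = trans (-‿cong (x-0#≈x 0#)) -0#≈0#

  a-letter-* : ∀ ω y → a [ ω ] * y ≈ - (γ^ ω * y)
  a-letter-* ω y = trans (*-congʳ (-‿cong (x-0#≈x (γ^ ω)))) (sym (-‿distribˡ-* (γ^ ω) y))

  -R-a-letter : ∀ ω y → - R (a [ ω ] * y) ≈ R (γ^ ω * y)
  -R-a-letter ω y = begin
      - R (a [ ω ] * y)
    ≈⟨ -‿cong (R-cong (a-letter-* ω y)) ⟩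
      - R (- (γ^ ω * y))
    ≈⟨ -‿cong (R-neg _) ⟩
      - - R (γ^ ω * y)
    ≈⟨ -‿involutive _ ⟩
      R (γ^ ω * y) ∎

  a⋆-∷ : ∀ (g : Word → Carrier) ω w → (a ⋆ g) (ω ∷ w) ≈ a [ ω ] * g w
  a⋆-∷ g ω [] = begin
      a [] * g [ ω ] + (a [ ω ] * g [] + 0#)
    ≈⟨ +-cong (trans (*-congʳ a-empty) (zeroˡ _)) (+-identityʳ _) ⟩
      0# + a [ ω ] * g []
    ≈⟨ +-identityˡ _ ⟩
      a [ ω ] * g [] ∎
  a⋆-∷ g ω (x ∷ w) = begin
      a [] * g (ω ∷ x ∷ w) + (a [ ω ] * g (x ∷ w) + long-prefixes (splits w))
    ≈⟨ +-cong (trans (*-congʳ a-empty) (zeroˡ _)) (+-congˡ (long-prefixes≈0 (splits w))) ⟩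
      0# + (a [ ω ] * g (x ∷ w) + 0#)
    ≈⟨ trans (+-identityˡ _) (+-identityʳ _) ⟩
      a [ ω ] * g (x ∷ w) ∎
    where
    long-prefixes : List (Word × Word) → Carrier
    long-prefixes ps = sumA (map (λ { (u , v) → a u * g v })
      (map (λ { (u , v) → (ω ∷ u , v) }) (map (λ { (u , v) → (x ∷ u , v) }) ps)))
    long-prefixes≈0 : ∀ ps → long-prefixes ps ≈ 0#
    long-prefixes≈0 [] = refl
    long-prefixes≈0 ((u , v) ∷ ps) =
      trans (+-cong (trans (*-congʳ (a-long ω x u)) (zeroˡ _)) (long-prefixes≈0 ps)) (+-identityˡ 0#)

  signedRa^-suc-∷ : ∀ n ω w → sgn (suc n) (Ra^ (suc n) (ω ∷ w)) ≈ R (γ^ ω * sgn n (Ra^ n w))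
  signedRa^-suc-∷ n ω w = begin
      sgn (suc n) (R ((a ⋆ Ra^ n) (ω ∷ w)))
    ≈⟨ sgn-suc n _ ⟩
      sgn n (- R ((a ⋆ Ra^ n) (ω ∷ w)))
    ≈⟨ sgn-cong n (-‿cong (R-cong (a⋆-∷ (Ra^ n) ω w))) ⟩
      sgn n (- R (a [ ω ] * Ra^ n w))
    ≈⟨ sgn-cong n (-R-a-letter ω _) ⟩
      sgn n (R (γ^ ω * Ra^ n w))
    ≈⟨ sgn-commute R R-cong R-neg n _ ⟨
      R (sgn n (γ^ ω * Ra^ n w))
    ≈⟨ R-cong (sgn-commute (γ^ ω *_) *-congˡ (λ x → sym (-‿distribʳ-* (γ^ ω) x)) n _) ⟨
      R (γ^ ω * sgn n (Ra^ n w)) ∎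

  H-empty : H [] ≈ 1#
  H-empty = +-identityʳ 1#

  -- The n = 0 term of H (ω ∷ w) is e (ω ∷ w) = 0; the remaining terms are
  -- those of H w, shifted by one.
  H-∷ : ∀ ω w → H (ω ∷ w) ≈ R (γ^ ω * H w)
  H-∷ ω w = begin
      0# + sumA (map term (applyUpTo suc (suc k)))
    ≈⟨ +-identityˡ _ ⟩
      sumA (map term (applyUpTo suc (suc k)))
    ≡⟨ ≡.cong sumA (≡.trans (map-applyUpTo suc term (suc k)) (≡.sym (map-upTo _ (suc k)))) ⟩
      sumA (map (λ n → term (suc n)) (upTo (suc k)))
    ≈⟨ sumA-cong (λ n → signedRa^-suc-∷ n ω w) (upTo (suc k)) ⟩
      sumA (map (λ n → R (γ^ ω * sgn n (Ra^ n w))) (upTo (suc k)))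
    ≈⟨ R-sum-scale (γ^ ω) (λ n → sgn n (Ra^ n w)) (upTo (suc k)) ⟩
      R (γ^ ω * H w) ∎
    where
    k : ℕ
    k = length w
    term : ℕ → Carrier
    term n = sgn n (Ra^ n (ω ∷ w))

  Hˡ-++ : ∀ xs ys → Hˡ (xs ++ ys) ≈ Hˡ xs + Hˡ ys
  Hˡ-++ [] ys = sym (+-identityˡ _)
  Hˡ-++ (x ∷ xs) ys = trans (+-congˡ (Hˡ-++ xs ys)) (sym (+-assoc _ _ _))

  Hˡ-map-∷ : ∀ ω xs → Hˡ (map (ω ∷_) xs) ≈ R (γ^ ω * Hˡ xs)
  Hˡ-map-∷ ω xs = begin
      sumA (map H (map (ω ∷_) xs))
    ≡⟨ ≡.cong sumA (map-∘ xs) ⟨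
      sumA (map (λ w → H (ω ∷ w)) xs)
    ≈⟨ sumA-cong (H-∷ ω) xs ⟩
      sumA (map (λ w → R (γ^ ω * H w)) xs)
    ≈⟨ R-sum-scale (γ^ ω) H xs ⟩
      R (γ^ ω * Hˡ xs) ∎

  Hˡ-++₃ : ∀ xs ys zs → Hˡ (xs ++ ys ++ zs) ≈ Hˡ xs + (Hˡ ys + Hˡ zs)
  Hˡ-++₃ xs ys zs = trans (Hˡ-++ xs (ys ++ zs)) (+-congˡ (Hˡ-++ ys zs))

  H-∗ : ∀ u v → Hˡ (u ∗ v) ≈ H u * H v
  H-∗ [] v = trans (+-identityʳ _) (trans (sym (*-identityˡ _)) (*-congʳ (sym H-empty)))
  H-∗ (x ∷ m) [] = trans (+-identityʳ _) (trans (sym (*-identityʳ _)) (*-congˡ (sym H-empty)))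
  H-∗ (x ∷ m) (y ∷ n) = begin
      Hˡ (map (x ∷_) (m ∗ (y ∷ n)) ++ map (y ∷_) ((x ∷ m) ∗ n) ++ map ((x +Ω y) ∷_) (m ∗ n))
    ≈⟨ Hˡ-++₃ (map (x ∷_) (m ∗ (y ∷ n))) (map (y ∷_) ((x ∷ m) ∗ n)) (map ((x +Ω y) ∷_) (m ∗ n)) ⟩
      Hˡ (map (x ∷_) (m ∗ (y ∷ n))) + (Hˡ (map (y ∷_) ((x ∷ m) ∗ n)) + Hˡ (map ((x +Ω y) ∷_) (m ∗ n)))
    ≈⟨ +-cong (Hˡ-map-∷ x (m ∗ (y ∷ n))) (+-cong (Hˡ-map-∷ y ((x ∷ m) ∗ n)) (Hˡ-map-∷ (x +Ω y) (m ∗ n))) ⟩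
      R (γ^ x * Hˡ (m ∗ (y ∷ n))) + (R (γ^ y * Hˡ ((x ∷ m) ∗ n)) + R (γ^ (x +Ω y) * Hˡ (m ∗ n)))
    ≈⟨ +-cong (R-cong (deconcat-x (H-∗ m (y ∷ n))))
         (+-cong (R-cong (deconcat-y (H-∗ (x ∷ m) n))) (R-cong (contract (H-∗ m n)))) ⟩
      R (p * R q) + (R (R p * q) + R (p * q))
    ≈⟨ R*R-expand p q ⟨
      R p * R q
    ≈⟨ *-cong (H-∷ x m) (H-∷ y n) ⟨
      H (x ∷ m) * H (y ∷ n) ∎
    where
    p q : Carrier
    p = γ^ x * H m
    q = γ^ y * H n
    deconcat-x : Hˡ (m ∗ (y ∷ n)) ≈ H m * H (y ∷ n) → γ^ x * Hˡ (m ∗ (y ∷ n)) ≈ p * R q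
    deconcat-x ih = trans (*-congˡ (trans ih (*-congˡ (H-∷ y n)))) (sym (*-assoc _ _ _))
    deconcat-y : Hˡ ((x ∷ m) ∗ n) ≈ H (x ∷ m) * H n → γ^ y * Hˡ ((x ∷ m) ∗ n) ≈ R p * q
    deconcat-y ih = trans (*-congˡ (trans ih (*-congʳ (H-∷ x m)))) (x∙yz≈y∙xz _ _ _)
    contract : Hˡ (m ∗ n) ≈ H m * H n → γ^ (x +Ω y) * Hˡ (m ∗ n) ≈ p * q
    contract ih = trans (*-cong (γ^-+Ω x y) ih) (interchange _ _ _ _)

  Hˡ-⊛ : ∀ xs ys → Hˡ (xs ⊛ ys) ≈ Hˡ xs * Hˡ ys
  Hˡ-⊛ [] ys = sym (zeroˡ _)
  Hˡ-⊛ (u ∷ xs) ys = begin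
      Hˡ (concatMap (u ∗_) ys ++ (xs ⊛ ys))
    ≈⟨ Hˡ-++ (concatMap (u ∗_) ys) (xs ⊛ ys) ⟩
      Hˡ (concatMap (u ∗_) ys) + Hˡ (xs ⊛ ys)
    ≈⟨ +-cong (H-∗-concatMap ys) (Hˡ-⊛ xs ys) ⟩
      H u * Hˡ ys + Hˡ xs * Hˡ ys
    ≈⟨ distribʳ _ _ _ ⟨
      (H u + Hˡ xs) * Hˡ ys ∎
    where
    H-∗-concatMap : ∀ ys → Hˡ (concatMap (u ∗_) ys) ≈ H u * Hˡ ys
    H-∗-concatMap [] = sym (zeroʳ _)
    H-∗-concatMap (v ∷ ys) = begin
        Hˡ (u ∗ v ++ concatMap (u ∗_) ys)
      ≈⟨ Hˡ-++ (u ∗ v) (concatMap (u ∗_) ys) ⟩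
        Hˡ (u ∗ v) + Hˡ (concatMap (u ∗_) ys)
      ≈⟨ +-cong (H-∗ u v) (H-∗-concatMap ys) ⟩
        H u * H v + H u * Hˡ ys
      ≈⟨ distribˡ _ _ _ ⟨
        H u * (H v + Hˡ ys) ∎

  H<-empty : H< [] ≈ 1#
  H<-empty = trans (+-identityʳ _) H-empty

  H<-[_] : ∀ t → H< [ t ] ≈ Hˡ (αT t)
  H<-[ t ] = trans (Hˡ-⊛ (αT t) (α [])) (trans (*-congˡ H<-empty) (*-identityʳ _))

  H<-prodA : ∀ ts → H< ts ≈ prodA (map (λ t → H< [ t ]) ts)
  H<-prodA [] = H<-empty
  H<-prodA (t ∷ ts) = trans (Hˡ-⊛ (αT t) (α ts)) (*-cong (sym H<-[ t ]) (H<-prodA ts))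

  H<-B⁺ : ∀ ω f → H< [ B⁺ ω f ] ≈ R (γ^ ω * H< f)
  H<-B⁺ ω f = trans H<-[ B⁺ ω f ] (Hˡ-map-∷ ω (α f))

  H<-B⁺-a : ∀ ω f → H< [ B⁺ ω f ] ≈ - R (a [ ω ] * H< f)
  H<-B⁺-a ω f = trans (H<-B⁺ ω f) (sym (-R-a-letter ω (H< f)))

mainTheorem4 : {c ℓ : Level} (A : CommutativeRing c ℓ) (R : CommutativeRing.Carrier A → CommutativeRing.Carrier A)
    → IsRotaBaxter A R → (γ : CommutativeRing.Carrier A)
    → let open CommutativeRing A
          open Setup A γ R
      in ((ts : List Tree) → H< ts ≈ prodA (map (λ t → H< [ t ]) ts))
         × ((ω₁ : Ω) (f : Forest) → (H< [ B⁺ ω₁ f ] ≈ - R (a [ ω₁ ] * H< f)) × (H< [ B⁺ ω₁ f ] ≈ R (γ^ ω₁ * H< f)))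
mainTheorem4 A R rb γ = H<-prodA , λ ω f → H<-B⁺-a ω f , H<-B⁺ ω f
  where open Properties A R rb γ
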